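{- Let $\mathcal{S}$ be a finite set of lattice polytopes in $\mathbb{R}^n$ which is a hierarchical basis, with $H$-matrix $H$. Then $\mathcal{S}$ is a positive basis if and only if for each row vector $v$ of $H$ there are no polytopes $S,S'\in\mathcal{S}$ (not necessarily distinct) such that $\mathrm{face}_v(S)$ is a proper face of $S$ and $\mathrm{face}_{ -v}(S')$ is a proper face of $S'$.
   Context: $\mathrm{face}_v(P)$ is the set of maximizers of $x\mapsto v\cdot x$ on $P$; a proper face of $P$ is a face that is neither $P$ nor a vertex of $P$. $P\equiv Q$ means $P=v+Q$ for some $v\in\mathbb{Z}^n$; $Q\le P$ means $Q$ is a Minkowski summand of $P$. $\mathbb{N}\mathcal{S}=\{$lattice $F:F\equiv\sum_{S}y_SS,\ y_S\in\mathbb{N}\}$. For a lattice polytope $P$ of dimension $k\ge1$, $H(P)$ has as rows the primitive outer normal vectors of the $(k-1)$-faces of $P$; if $Q\le cP$ for an integer $c>0$, $b^{H(P)}(Q)$ is the coordinatewise minimal integer $b$ with $Q=\{x:H(P)x\le b\}$. The $H$-matrix of $\mathcal{S}$ is $H=H(\sum_{S\in\mathcal{S}}S)$; $\mathcal{S}$ is a basis if $\{b^H(S):S\in\mathcal{S}\}$ is a $\mathbb{Z}$-basis of the group it generates. $\mathcal{S}$ is hierarchical if every proper face of every $S\in\mathcal{S}$ lies in $\mathbb{N}\mathcal{S}$ (then the rows of $H$ are closed under negation). An orientation is a map $\tau$ from rows of $H$ to $\{\pm1\}$ with $\tau(-v)=-\tau(v)$; $\mathcal{S}$ is positive with orientation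 $\tau$ if for each row $v$ with $\tau(v)=+1$ and each $S\in\mathcal{S}$, $\mathrm{face}_{ -v}(S)$ is not a proper face of $S$. A positive basis is a hierarchical basis that is positive with respect to some orientation. -}

module Defs where

open import Level using (0ℓ)
open import Data.Nat as ℕ using (ℕ; zero; suc)
open import Data.Nat.Divisibility using (_∣_)
open import Data.Integer as ℤ using (ℤ; +_; ∣_∣)
open import Data.Rational as ℚ using (ℚ; 0ℚ; 1ℚ)
open import Data.Fin using (Fin; zero; suc)
open import Data.Bool using (Bool; true; false)
open import Data.Product using (Σ; ∃; ∃-syntax; Σ-syntax; _×_; _,_)
open import Data.Empty using (⊥)
open import Relation.Nullary using (¬_)
open import Relation.Binary.PropositionalEquality using (_≡_; _≢_)
open import Function.Definitions using (Injective)

Pt : ℕ → Set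
Pt n = Fin n → ℚ

ZPt : ℕ → Set
ZPt n = Fin n → ℤ

Σℚ : ∀ {m} → (Fin m → ℚ) → ℚ
Σℚ {zero}  f = 0ℚ
Σℚ {suc m} f = f zero ℚ.+ Σℚ (λ j → f (suc j))

Σℤ : ∀ {m} → (Fin m → ℤ) → ℤ
Σℤ {zero}  f = + 0
Σℤ {suc m} f = f zero ℤ.+ Σℤ (λ j → f (suc j))

ι : ℤ → ℚ
ι z = z ℚ./ 1

ιv : ∀ {n} → ZPt n → Pt n
ιv v i = ι (v i)

_·_ : ∀ {n} → Pt n → Pt n → ℚ
u · x = Σℚ (λ i → u i ℚ.* x i)

_⊕_ : ∀ {n} → Pt n → Pt n → Pt n
(x ⊕ y) i = x i ℚ.+ y i

_⊖_ : ∀ {n} → Pt n → Pt n → Pt n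
(x ⊖ y) i = x i ℚ.- y i

_⊛_ : ∀ {n} → ℚ → Pt n → Pt n
(c ⊛ x) i = c ℚ.* x i

zeroPt : ∀ {n} → Pt n
zeroPt i = 0ℚ

negZ : ∀ {n} → ZPt n → ZPt n
negZ v i = ℤ.- (v i)

lincomb : ∀ {n m} → (Fin m → ℚ) → (Fin m → Pt n) → Pt n
lincomb c p i = Σℚ (λ j → c j ℚ.* p j i)

_≈ₚ_ : ∀ {n} → Pt n → Pt n → Set
x ≈ₚ y = ∀ i → x i ≡ y i

PSet : ℕ → Set₁
PSet n = Pt n → Set

_≃_ : ∀ {n} → PSet n → PSet n → Set
P ≃ Q = ∀ x → (P x → Q x) × (Q x → P x)

_+ₘ_ : ∀ {n} → PSet n → PSet n → PSet n
(P +ₘ Q) x = ∃[ p ] ∃[ q ] (P p × Q q × x ≈ₚ (p ⊕ q))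

singleton : ∀ {n} → Pt n → PSet n
singleton p x = x ≈ₚ p

dil : ∀ {n} → ℕ → PSet n → PSet n
dil c P x = ∃[ p ] (P p × x ≈ₚ ((+ c ℚ./ 1) ⊛ p))

-- ℕ-dilation as repeated Minkowski sum is the same for convex sets;
-- we use the pointwise dilation c·S = {c x : x ∈ S} (with 0·S = {0}).

translate : ∀ {n} → ZPt n → PSet n → PSet n
translate t Q x = ∃[ q ] (Q q × x ≈ₚ (ιv t ⊕ q))

_≡ₗ_ : ∀ {n} → PSet n → PSet n → Set
P ≡ₗ Q = ∃[ t ] (P ≃ translate t Q)

ΣM : ∀ {n m} → (Fin m → PSet n) → PSet n
ΣM {n} {zero}  F = singleton zeroPt
ΣM {n} {suc m} F = F zero +ₘ ΣM (λ j → F (suc j))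

record LatticePolytope (n : ℕ) : Set where
  constructor lpoly
  field
    size  : ℕ
    verts : Fin (suc size) → ZPt n

open LatticePolytope public

⟦_⟧ : ∀ {n} → LatticePolytope n → PSet n
⟦ P ⟧ x =
  ∃[ w ] ((∀ j → 0ℚ ℚ.≤ w j) × Σℚ w ≡ 1ℚ
          × x ≈ₚ lincomb w (λ j → ιv (verts P j)))

face : ∀ {n} → Pt n → PSet n → PSet n
face v P x = P x × (∀ y → P y → v · y ℚ.≤ v · x)

IsVertex : ∀ {n} → PSet n → PSet n → Set
IsVertex P F = (∃[ u ] F ≃ face u P) × (∃[ p ] F ≃ singleton p)

IsProperFace : ∀ {n} → PSet n → PSet n → Set
IsProperFace F P = (∃[ u ] F ≃ face u P) × ¬ (F ≃ P) × ¬ IsVertex P F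

AffIndep : ∀ {n k} → (Fin (suc k) → Pt n) → Set
AffIndep {n} {k} p =
  ∀ (c : Fin (suc k) → ℚ) → Σℚ c ≡ 0ℚ → lincomb c p ≈ₚ zeroPt → ∀ j → c j ≡ 0ℚ

HasDim : ∀ {n} → PSet n → ℕ → Set
HasDim P k =
  (∃[ p ] ((∀ j → P (p j)) × AffIndep {k = k} p))
  × (∀ (p : Fin (suc (suc k)) → _) → (∀ j → P (p j)) → ¬ AffIndep p)

InDirSpace : ∀ {n} → PSet n → Pt n → Set
InDirSpace {n} P v =
  ∃[ m ] Σ[ p ∈ (Fin m → Pt n) ] Σ[ q ∈ (Fin m → Pt n) ] Σ[ c ∈ (Fin m → ℚ) ]
    ((∀ (j : Fin m) → P (p j)) × (∀ j → P (q j))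
     × v ≈ₚ lincomb c (λ j → p j ⊖ q j))

Primitive : ∀ {n} → ZPt n → Set
Primitive v = ∀ (d : ℕ) → (∀ i → d ∣ ∣ v i ∣) → d ≡ 1

-- v is a primitive outer normal of a (k−1)-face of P, where dim P = k = suc k'
IsFacetNormal : ∀ {n} → PSet n → ℕ → ZPt n → Set
IsFacetNormal P k' v =
  Primitive v × InDirSpace P (ιv v) × HasDim (face (ιv v) P) k'

IsHMatrix : ∀ {n r} → PSet n → (Fin r → ZPt n) → Set
IsHMatrix P H =
  ∃[ k' ] (HasDim P (suc k')
    × Injective _≡_ _≡_ H
    × (∀ i → IsFacetNormal P k' (H i))
    × (∀ v → IsFacetNormal P k' v → ∃[ i ] H i ≡ v))

HPoly : ∀ {n r} → (Fin r → ZPt n) → (Fin r → ℤ) → PSet n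
HPoly H b x = ∀ i → ιv (H i) · x ℚ.≤ ι (b i)

IsBH : ∀ {n r} → (Fin r → ZPt n) → PSet n → (Fin r → ℤ) → Set
IsBH H Q b = Q ≃ HPoly H b × (∀ b′ → Q ≃ HPoly H b′ → ∀ i → b i ℤ.≤ b′ i)

Fam : ℕ → ℕ → Set
Fam n m = Fin m → LatticePolytope n

Distinct : ∀ {n m} → Fam n m → Set
Distinct S = ∀ i j → ⟦ S i ⟧ ≃ ⟦ S j ⟧ → i ≡ j

InNS : ∀ {n m} → Fam n m → PSet n → Set
InNS {n} {m} S F =
  Σ[ P ∈ LatticePolytope n ] (F ≃ ⟦ P ⟧) × Σ[ y ∈ (Fin m → ℕ) ] (F ≡ₗ ΣM (λ (s : Fin m) → dil (y s) ⟦ S s ⟧))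

Hierarchical : ∀ {n m} → Fam n m → Set
Hierarchical S =
  ∀ s (u : Pt _) → IsProperFace (face u ⟦ S s ⟧) ⟦ S s ⟧
    → InNS S (face u ⟦ S s ⟧)

ΣS : ∀ {n m} → Fam n m → PSet n
ΣS S = ΣM (λ s → ⟦ S s ⟧)

-- basis w.r.t. the H-matrix H: {b^H(S)} is a ℤ-basis of the group it
-- generates, i.e. the (pairwise distinct) vectors b^H(S) are ℤ-independent
IsBasis : ∀ {n m r} → Fam n m → (Fin r → ZPt n) → Set
IsBasis {m = m} {r = r} S H =
  Σ[ b ∈ (Fin m → Fin r → ℤ) ] ((∀ s → IsBH H ⟦ S s ⟧ (b s))
    × (∀ (c : Fin m → ℤ) → (∀ i → Σℤ (λ s → c s ℤ.* b s i) ≡ + 0)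
         → ∀ s → c s ≡ + 0))

-- orientation: τ(i) = true means +1
IsOrientation : ∀ {n r} → (Fin r → ZPt n) → (Fin r → Bool) → Set
IsOrientation H τ = ∀ i j → (∀ k → H j k ≡ negZ (H i) k) → τ j ≢ τ i

IsPositive : ∀ {n m r} → Fam n m → (Fin r → ZPt n) → (Fin r → Bool) → Set
IsPositive S H τ =
  IsOrientation H τ
  × (∀ i → τ i ≡ true → ∀ s →
       ¬ IsProperFace (face (ιv (negZ (H i))) ⟦ S s ⟧) ⟦ S s ⟧)

IsPositiveBasis : ∀ {n m r} → Fam n m → (Fin r → ZPt n) → Set
IsPositiveBasis S H =
  Hierarchical S × IsBasis S H × ∃[ τ ] IsPositive S H τ

-- (⇒) If face_v(S) and face_{−v}(S′) are both proper, whichever of v and −v the orientation makes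
-- positive violates positivity; this needs −v to be a row of H as well. That closure under negation is
-- the heart of the argument. For a facet normal v of ΣS every face_v(S) is S itself, a vertex, or, by
-- hierarchy, a lattice translate of Σ y_r S_r, and v is constant on each S_r occurring there. So the
-- summands of a point p of face_v(ΣS) are v-minimal in their S_r; regrouped by r and padded with the
-- v-minimal vertices they give a point q₀ + κ p of face_{−v}(ΣS), with q₀ and κ > 0 independent of p.
-- Hence face_{−v}(ΣS) has the dimension of a facet too.
-- (⇐) Orient v positively if some face_v(S) is proper, negatively if some face_{−v}(S) is, and by the
-- sign of its first nonzero coordinate otherwise: the hypothesis makes the first two cases exclusive,
-- and properness of a face of a polytope is decidable since the polytope has finitely many vertices.

module Submission where

open import Defs
open import Data.Nat using (ℕ; zero; suc)
open import Data.Nat.Divisibility using (_∣_; _∣0)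
open import Data.Integer as ℤ using (-[1+_])
import Data.Integer.Properties as ℤP
open import Data.Rational as ℚ using (ℚ; 0ℚ; 1ℚ; _+_; _*_; _-_; -_; _≤_; _<_)
import Data.Rational.Properties as ℚP
open import Data.Rational.Solver using (module +-*-Solver)
open import Data.Fin using (Fin; zero; suc)
import Data.Fin.Properties as FinP
open import Data.Product using (∃-syntax; Σ-syntax; _×_; _,_; proj₁; proj₂)
open import Data.Vec.Functional using (updateAt)
open import Data.Vec.Functional.Properties using (updateAt-updates; updateAt-minimal)
open import Data.Bool using (Bool; true; false; if_then_else_; _∧_)
open import Data.Empty using (⊥; ⊥-elim)
open import Function.Bundles using (mk⇔)
open import Relation.Nullary using (¬_; Dec; yes; no; does)
open import Relation.Nullary.Decidable using (does-⇔; dec-true; dec-false; decidable-stable; ¬?; _×-dec_)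
open import Relation.Binary.PropositionalEquality
open import Algebra.Bundles using (CommutativeMonoid)
open import Algebra.Properties.Group ℚP.+-0-group using (x∙y⁻¹≈ε⇒x≈y; x≈y⇒x∙y⁻¹≈ε)
open import Algebra.Properties.CommutativeSemigroup (CommutativeMonoid.commutativeSemigroup ℚP.+-0-commutativeMonoid)
  using () renaming (interchange to +-interchange)
open import Algebra.Properties.CommutativeSemigroup (CommutativeMonoid.commutativeSemigroup ℚP.*-1-commutativeMonoid)
  using () renaming (x∙yz≈y∙xz to *-leftSwap)

open +-*-Solver using (solve; _:=_; _:+_; _:*_; _:-_; :-_; con)

*-nonneg : ∀ {p q} → 0ℚ ≤ p → 0ℚ ≤ q → 0ℚ ≤ p * q
*-nonneg {p} {q} 0≤p 0≤q = ℚP.nonNegative⁻¹ (p * q)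
  {{ℚP.nonNeg*nonNeg⇒nonNeg p {{ℚ.nonNegative 0≤p}} q {{ℚ.nonNegative 0≤q}}}}

*-monoˡ-≤-0≤ : ∀ {r p q} → 0ℚ ≤ r → p ≤ q → r * p ≤ r * q
*-monoˡ-≤-0≤ {r} 0≤r = ℚP.*-monoˡ-≤-nonNeg r {{ℚ.nonNegative 0≤r}}

p≤q⇒0≤q-p : ∀ {p q} → p ≤ q → 0ℚ ≤ q - p
p≤q⇒0≤q-p {p} {q} p≤q = subst (_≤ q - p) (ℚP.+-inverseʳ p) (ℚP.+-monoˡ-≤ (- p) p≤q)

p-q≡0⇒p≡q : ∀ {p q} → p - q ≡ 0ℚ → p ≡ q
p-q≡0⇒p≡q = x∙y⁻¹≈ε⇒x≈y _ _

p≡q⇒p-q≡0 : ∀ {p q} → p ≡ q → p - q ≡ 0ℚ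
p≡q⇒p-q≡0 = x≈y⇒x∙y⁻¹≈ε

p*q≡0⇒q≡0 : ∀ {p q} → p ≢ 0ℚ → p * q ≡ 0ℚ → q ≡ 0ℚ
p*q≡0⇒q≡0 {p} {q} p≢0 pq≡0 = begin
  q                  ≡⟨ sym (ℚP.*-identityˡ q) ⟩
  1ℚ * q             ≡⟨ cong (_* q) (sym (ℚP.*-inverseˡ p)) ⟩
  (ℚ.1/ p) * p * q   ≡⟨ ℚP.*-assoc (ℚ.1/ p) p q ⟩
  (ℚ.1/ p) * (p * q) ≡⟨ cong ((ℚ.1/ p) *_) pq≡0 ⟩
  (ℚ.1/ p) * 0ℚ      ≡⟨ ℚP.*-zeroʳ (ℚ.1/ p) ⟩
  0ℚ                 ∎
  where
  open ≡-Reasoning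
  instance
    _ : ℚ.NonZero p
    _ = ℚ.≢-nonZero p≢0

*-congˡ-on-support : ∀ ω {x c} → (ω ≢ 0ℚ → x ≡ c) → ω * x ≡ ω * c
*-congˡ-on-support ω {x} {c} h with ω ℚP.≟ 0ℚ
... | yes refl = trans (ℚP.*-zeroˡ x) (sym (ℚP.*-zeroˡ c))
... | no ω≢0   = cong (ω *_) (h ω≢0)

ι-neg : ∀ z → ι (ℤ.- z) ≡ - ι z
ι-neg (ℤ.+ zero)  = refl
ι-neg (ℤ.+ suc n) = refl
ι-neg -[1+ n ]    = solve 1 (λ x → x := :- :- x) refl (ι (ℤ.+ suc n))

ι-nonneg : ∀ k → 0ℚ ≤ ι (ℤ.+ k)
ι-nonneg k = ℚP.nonNegative⁻¹ (ι (ℤ.+ k)) {{ℚP.normalize-nonNeg k 1}}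

ι-nonzero : ∀ {k} → k ≢ 0 → ι (ℤ.+ k) ≢ 0ℚ
ι-nonzero {zero}  k≢0 = ⊥-elim (k≢0 refl)
ι-nonzero {suc k} _ e = ℚP.<-irrefl (sym e) (ℚP.positive⁻¹ (ι (ℤ.+ suc k)) {{ℚP.normalize-pos (suc k) 1}})

Σ-cong : ∀ {m} {f g : Fin m → ℚ} → (∀ j → f j ≡ g j) → Σℚ f ≡ Σℚ g
Σ-cong {zero}  f≗g = refl
Σ-cong {suc m} f≗g = cong₂ _+_ (f≗g zero) (Σ-cong (λ j → f≗g (suc j)))

Σ-zero : ∀ m → Σℚ {m} (λ _ → 0ℚ) ≡ 0ℚ
Σ-zero zero    = refl
Σ-zero (suc m) = trans (ℚP.+-identityˡ _) (Σ-zero m)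

Σ-distrib-+ : ∀ {m} (f g : Fin m → ℚ) → Σℚ (λ j → f j + g j) ≡ Σℚ f + Σℚ g
Σ-distrib-+ {zero}  f g = refl
Σ-distrib-+ {suc m} f g =
  trans (cong (f zero + g zero +_) (Σ-distrib-+ (λ j → f (suc j)) (λ j → g (suc j))))
        (+-interchange (f zero) (g zero) _ _)

Σ-distribˡ-* : ∀ {m} c (f : Fin m → ℚ) → Σℚ (λ j → c * f j) ≡ c * Σℚ f
Σ-distribˡ-* {zero}  c f = sym (ℚP.*-zeroʳ c)
Σ-distribˡ-* {suc m} c f =
  trans (cong (c * f zero +_) (Σ-distribˡ-* c (λ j → f (suc j)))) (sym (ℚP.*-distribˡ-+ c (f zero) _))

Σ-distribʳ-* : ∀ {m} c (f : Fin m → ℚ) → Σℚ (λ j → f j * c) ≡ Σℚ f * c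
Σ-distribʳ-* c f = trans (Σ-cong (λ j → ℚP.*-comm (f j) c))
                         (trans (Σ-distribˡ-* c f) (ℚP.*-comm c (Σℚ f)))

Σ-neg : ∀ {m} (f : Fin m → ℚ) → Σℚ (λ j → - f j) ≡ - Σℚ f
Σ-neg {zero}  f = refl
Σ-neg {suc m} f = trans (cong (- f zero +_) (Σ-neg (λ j → f (suc j)))) (sym (ℚP.neg-distrib-+ (f zero) _))

Σ-distrib-- : ∀ {m} (f g : Fin m → ℚ) → Σℚ (λ j → f j - g j) ≡ Σℚ f - Σℚ g
Σ-distrib-- f g = trans (Σ-distrib-+ f (λ j → - g j)) (cong (Σℚ f +_) (Σ-neg g))

Σ-comm : ∀ {m k} (f : Fin m → Fin k → ℚ) →
         Σℚ (λ i → Σℚ (f i)) ≡ Σℚ (λ j → Σℚ (λ i → f i j))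
Σ-comm {zero}  {k} f = sym (Σ-zero k)
Σ-comm {suc m} {k} f = trans (cong (Σℚ (f zero) +_) (Σ-comm (λ i → f (suc i))))
                             (sym (Σ-distrib-+ (f zero) (λ j → Σℚ (λ i → f (suc i) j))))

Σ-convex-const : ∀ {m} (w : Fin m → ℚ) c → Σℚ w ≡ 1ℚ → Σℚ (λ j → w j * c) ≡ c
Σ-convex-const w c Σw≡1 = trans (Σ-distribʳ-* c w) (trans (cong (_* c) Σw≡1) (ℚP.*-identityˡ c))

Σ-mono-≤ : ∀ {m} {f g : Fin m → ℚ} → (∀ j → f j ≤ g j) → Σℚ f ≤ Σℚ g
Σ-mono-≤ {zero}  f≤g = ℚP.≤-refl
Σ-mono-≤ {suc m} f≤g = ℚP.+-mono-≤ (f≤g zero) (Σ-mono-≤ (λ j → f≤g (suc j)))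

Σ-nonneg : ∀ {m} {f : Fin m → ℚ} → (∀ j → 0ℚ ≤ f j) → 0ℚ ≤ Σℚ f
Σ-nonneg {m} {f} 0≤f = subst (_≤ Σℚ f) (Σ-zero m) (Σ-mono-≤ 0≤f)

term≤Σ : ∀ {m} {f : Fin m → ℚ} → (∀ j → 0ℚ ≤ f j) → ∀ r → f r ≤ Σℚ f
term≤Σ {f = f} 0≤f zero = subst (_≤ Σℚ f) (ℚP.+-identityʳ (f zero))
  (ℚP.+-monoʳ-≤ (f zero) (Σ-nonneg (λ j → 0≤f (suc j))))
term≤Σ {f = f} 0≤f (suc r) = ℚP.≤-trans (term≤Σ (λ j → 0≤f (suc j)) r)
  (subst (_≤ Σℚ f) (ℚP.+-identityˡ _) (ℚP.+-monoˡ-≤ (Σℚ (λ j → f (suc j))) (0≤f zero)))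

Σ-nonneg≡0⇒≡0 : ∀ {m} {f : Fin m → ℚ} → (∀ j → 0ℚ ≤ f j) → Σℚ f ≡ 0ℚ →
                ∀ j → f j ≡ 0ℚ
Σ-nonneg≡0⇒≡0 0≤f Σf≡0 r = ℚP.≤-antisym (subst (_ ≤_) Σf≡0 (term≤Σ 0≤f r)) (0≤f r)

Σ-≤-tight : ∀ {m} {f g : Fin m → ℚ} → (∀ j → f j ≤ g j) → Σℚ g ≤ Σℚ f →
            ∀ j → f j ≡ g j
Σ-≤-tight {f = f} {g} f≤g Σg≤Σf j =
  sym (p-q≡0⇒p≡q (Σ-nonneg≡0⇒≡0 (λ j → p≤q⇒0≤q-p (f≤g j)) Σ[g-f]≡0 j))
  where
  Σg-Σf≤0 : Σℚ g - Σℚ f ≤ 0ℚ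
  Σg-Σf≤0 = subst (Σℚ g - Σℚ f ≤_) (ℚP.+-inverseʳ (Σℚ f)) (ℚP.+-monoˡ-≤ (- Σℚ f) Σg≤Σf)
  Σ[g-f]≡0 : Σℚ (λ j → g j - f j) ≡ 0ℚ
  Σ[g-f]≡0 = trans (Σ-distrib-- g f)
                   (ℚP.≤-antisym Σg-Σf≤0 (p≤q⇒0≤q-p (Σ-mono-≤ f≤g)))

δ : ∀ {m} → Fin m → Fin m → ℚ
δ k j = if does (k FinP.≟ j) then 1ℚ else 0ℚ

δ-nonneg : ∀ {m} (k j : Fin m) → 0ℚ ≤ δ k j
δ-nonneg k j with k FinP.≟ j
... | yes _ = ℚP.nonNegative⁻¹ 1ℚ
... | no  _ = ℚP.≤-refl

Σ-δ : ∀ {m} (k : Fin m) (f : Fin m → ℚ) → Σℚ (λ j → δ k j * f j) ≡ f k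
Σ-δ {suc m} zero f = begin
  1ℚ * f zero + Σℚ (λ j → 0ℚ * f (suc j))
    ≡⟨ cong₂ _+_ (ℚP.*-identityˡ (f zero)) (Σ-cong (λ j → ℚP.*-zeroˡ (f (suc j)))) ⟩
  f zero + Σℚ {m} (λ _ → 0ℚ)
    ≡⟨ cong (f zero +_) (Σ-zero m) ⟩
  f zero + 0ℚ
    ≡⟨ ℚP.+-identityʳ (f zero) ⟩
  f zero ∎
  where open ≡-Reasoning
Σ-δ {suc m} (suc k) f = begin
  0ℚ * f zero + Σℚ (λ j → δ (suc k) (suc j) * f (suc j)) ≡⟨ cong₂ _+_ (ℚP.*-zeroˡ (f zero)) (Σ-cong δ-suc) ⟩
  0ℚ + Σℚ (λ j → δ k j * f (suc j))                      ≡⟨ ℚP.+-identityˡ _ ⟩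
  Σℚ (λ j → δ k j * f (suc j))                           ≡⟨ Σ-δ k (λ j → f (suc j)) ⟩
  f (suc k)                                              ∎
  where
  open ≡-Reasoning
  δ-suc : ∀ j → δ (suc k) (suc j) * f (suc j) ≡ δ k j * f (suc j)
  δ-suc j with k FinP.≟ j
  ... | yes _ = refl
  ... | no  _ = refl

Σ-δ≡1 : ∀ {m} (k : Fin m) → Σℚ (δ k) ≡ 1ℚ
Σ-δ≡1 k = trans (Σ-cong (λ j → sym (ℚP.*-identityʳ (δ k j)))) (Σ-δ k (λ _ → 1ℚ))

Σ-differ-at : ∀ {m} (r : Fin m) (f g : Fin m → ℚ) → (∀ j → j ≢ r → f j ≡ g j) →
              Σℚ f - Σℚ g ≡ f r - g r
Σ-differ-at r f g f≡g-off-r = begin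
  Σℚ f - Σℚ g                    ≡⟨ sym (Σ-distrib-- f g) ⟩
  Σℚ (λ j → f j - g j)           ≡⟨ Σ-cong termwise ⟩
  Σℚ (λ j → δ r j * (f r - g r)) ≡⟨ Σ-δ r (λ _ → f r - g r) ⟩
  f r - g r                      ∎
  where
  open ≡-Reasoning
  termwise : ∀ j → f j - g j ≡ δ r j * (f r - g r)
  termwise j with r FinP.≟ j
  ... | yes refl = sym (ℚP.*-identityˡ (f r - g r))
  ... | no  r≢j  = trans (p≡q⇒p-q≡0 (f≡g-off-r j (λ j≡r → r≢j (sym j≡r))))
                         (sym (ℚP.*-zeroˡ (f r - g r)))

Σpt : ∀ {n m} → (Fin m → Pt n) → Pt n
Σpt c i = Σℚ (λ s → c s i)

·-congʳ : ∀ {n} (u : Pt n) {x y : Pt n} → x ≈ₚ y → u · x ≡ u · y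
·-congʳ u x≈y = Σ-cong (λ i → cong (u i *_) (x≈y i))

·-congˡ : ∀ {n} {u v : Pt n} (x : Pt n) → u ≈ₚ v → u · x ≡ v · x
·-congˡ x u≈v = Σ-cong (λ i → cong (_* x i) (u≈v i))

·-distrib-⊕ : ∀ {n} (u x y : Pt n) → u · (x ⊕ y) ≡ u · x + u · y
·-distrib-⊕ u x y = trans (Σ-cong (λ i → ℚP.*-distribˡ-+ (u i) (x i) (y i)))
                          (Σ-distrib-+ (λ i → u i * x i) (λ i → u i * y i))

·-⊛ : ∀ {n} (u : Pt n) c (x : Pt n) → u · (c ⊛ x) ≡ c * (u · x)
·-⊛ u c x = trans (Σ-cong (λ i → *-leftSwap (u i) c (x i))) (Σ-distribˡ-* c (λ i → u i * x i))

·-zeroʳ : ∀ {n} (u : Pt n) → u · zeroPt ≡ 0ℚ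
·-zeroʳ {n} u = trans (Σ-cong (λ i → ℚP.*-zeroʳ (u i))) (Σ-zero n)

·-Σpt : ∀ {n m} (u : Pt n) (c : Fin m → Pt n) → u · Σpt c ≡ Σℚ (λ s → u · c s)
·-Σpt u c = trans (Σ-cong (λ i → sym (Σ-distribˡ-* (u i) (λ s → c s i)))) (Σ-comm (λ i s → u i * c s i))

·-lincomb : ∀ {n m} (u : Pt n) (c : Fin m → ℚ) (p : Fin m → Pt n) →
            u · lincomb c p ≡ Σℚ (λ j → c j * (u · p j))
·-lincomb u c p = begin
  Σℚ (λ i → u i * Σℚ (λ j → c j * p j i))   ≡⟨ Σ-cong (λ i → sym (Σ-distribˡ-* (u i) (λ j → c j * p j i))) ⟩
  Σℚ (λ i → Σℚ (λ j → u i * (c j * p j i))) ≡⟨ Σ-comm (λ i j → u i * (c j * p j i)) ⟩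
  Σℚ (λ j → Σℚ (λ i → u i * (c j * p j i))) ≡⟨ Σ-cong (λ j → trans (Σ-cong (λ i → *-leftSwap (u i) (c j) (p j i)))
                                                                   (Σ-distribˡ-* (c j) (λ i → u i * p j i))) ⟩
  Σℚ (λ j → c j * (u · p j))                ∎
  where open ≡-Reasoning

·-negZ : ∀ {n} (v : ZPt n) (x : Pt n) → ιv (negZ v) · x ≡ - (ιv v · x)
·-negZ v x = trans (Σ-cong (λ i → trans (cong (_* x i) (ι-neg (v i))) (sym (ℚP.neg-distribˡ-* (ιv v i) (x i)))))
                   (Σ-neg (λ i → ιv v i * x i))

≈ₚ-sym : ∀ {n} {x y : Pt n} → x ≈ₚ y → y ≈ₚ x
≈ₚ-sym x≈y i = sym (x≈y i)

≈ₚ-trans : ∀ {n} {x y z : Pt n} → x ≈ₚ y → y ≈ₚ z → x ≈ₚ z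
≈ₚ-trans x≈y y≈z i = trans (x≈y i) (y≈z i)

_≈ₚ?_ : ∀ {n} (x y : Pt n) → Dec (x ≈ₚ y)
x ≈ₚ? y = FinP.all? (λ i → x i ℚP.≟ y i)

≃-refl : ∀ {n} {P : PSet n} → P ≃ P
≃-refl x = (λ Px → Px) , (λ Px → Px)

≃-sym : ∀ {n} {P Q : PSet n} → P ≃ Q → Q ≃ P
≃-sym P≃Q x = proj₂ (P≃Q x) , proj₁ (P≃Q x)

≃-trans : ∀ {n} {P Q R : PSet n} → P ≃ Q → Q ≃ R → P ≃ R
≃-trans P≃Q Q≃R x = (λ Px → proj₁ (Q≃R x) (proj₁ (P≃Q x) Px)) ,
                     (λ Rx → proj₂ (P≃Q x) (proj₂ (Q≃R x) Rx))

face-cong : ∀ {n} {u v : Pt n} (P : PSet n) → u ≈ₚ v → face u P ≃ face v P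
face-cong {u = u} {v} P u≈v x = transport u≈v , transport (≈ₚ-sym u≈v)
  where
  transport : ∀ {u v} → u ≈ₚ v → face u P x → face v P x
  transport u≈v (Px , max) = Px , λ y Py → subst₂ _≤_ (·-congˡ y u≈v) (·-congˡ x u≈v) (max y Py)

IsProperFace-resp : ∀ {n} {F G P : PSet n} → F ≃ G → IsProperFace F P → IsProperFace G P
IsProperFace-resp F≃G ((w , F≃face) , F≄P , F-not-vertex) =
  (w , ≃-trans (≃-sym F≃G) F≃face) ,
  (λ G≃P → F≄P (≃-trans F≃G G≃P)) ,
  (λ { ((w′ , G≃face) , (p , G≃p)) →
        F-not-vertex ((w′ , ≃-trans F≃G G≃face) , (p , ≃-trans F≃G G≃p)) })

-- Lattice polytopes and their faces

vertex : ∀ {n} (P : LatticePolytope n) → Fin (suc (size P)) → Pt n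
vertex P j = ιv (verts P j)

∈-resp-≈ₚ : ∀ {n} (P : LatticePolytope n) {x y : Pt n} → ⟦ P ⟧ x → x ≈ₚ y → ⟦ P ⟧ y
∈-resp-≈ₚ P (w , w≥0 , Σw≡1 , x≈) x≈y = w , w≥0 , Σw≡1 , ≈ₚ-trans (≈ₚ-sym x≈y) x≈

vertex∈ : ∀ {n} (P : LatticePolytope n) k → ⟦ P ⟧ (vertex P k)
vertex∈ P k = δ k , δ-nonneg k , Σ-δ≡1 k , λ i → sym (Σ-δ k (λ j → vertex P j i))

·-on-polytope : ∀ {n} (u : Pt n) (P : LatticePolytope n) {x} (x∈P : ⟦ P ⟧ x) →
                u · x ≡ Σℚ (λ j → proj₁ x∈P j * (u · vertex P j))
·-on-polytope u P (w , _ , _ , x≈) = trans (·-congʳ u x≈) (·-lincomb u w (vertex P))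

convex-combination∈ : ∀ {n K} (P : LatticePolytope n) (ω : Fin K → ℚ) (z : Fin K → Pt n) →
                      (∀ l → 0ℚ ≤ ω l) → Σℚ ω ≡ 1ℚ → (∀ l → ⟦ P ⟧ (z l)) →
                      ⟦ P ⟧ (lincomb ω z)
convex-combination∈ {K = K} P ω z ω≥0 Σω≡1 z∈P = W , W≥0 , ΣW≡1 , combination
  where
  w : Fin K → Fin (suc (size P)) → ℚ
  w l = proj₁ (z∈P l)
  W : Fin (suc (size P)) → ℚ
  W j = Σℚ (λ l → ω l * w l j)
  W≥0 : ∀ j → 0ℚ ≤ W j
  W≥0 j = Σ-nonneg (λ l → *-nonneg (ω≥0 l) (proj₁ (proj₂ (z∈P l)) j))
  ΣW≡1 : Σℚ W ≡ 1ℚ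
  ΣW≡1 = begin
    Σℚ W                              ≡⟨ sym (Σ-comm (λ l j → ω l * w l j)) ⟩
    Σℚ (λ l → Σℚ (λ j → ω l * w l j)) ≡⟨ Σ-cong (λ l → Σ-distribˡ-* (ω l) (w l)) ⟩
    Σℚ (λ l → ω l * Σℚ (w l))         ≡⟨ Σ-cong (λ l → cong (ω l *_) (proj₁ (proj₂ (proj₂ (z∈P l))))) ⟩
    Σℚ (λ l → ω l * 1ℚ)               ≡⟨ Σ-convex-const ω 1ℚ Σω≡1 ⟩
    1ℚ                                ∎
    where open ≡-Reasoning
  combination : lincomb ω z ≈ₚ lincomb W (vertex P)
  combination i = begin
    Σℚ (λ l → ω l * z l i)
      ≡⟨ Σ-cong (λ l → cong (ω l *_) (proj₂ (proj₂ (proj₂ (z∈P l))) i)) ⟩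
    Σℚ (λ l → ω l * Σℚ (λ j → w l j * vertex P j i))
      ≡⟨ Σ-cong (λ l → sym (Σ-distribˡ-* (ω l) (λ j → w l j * vertex P j i))) ⟩
    Σℚ (λ l → Σℚ (λ j → ω l * (w l j * vertex P j i)))
      ≡⟨ Σ-comm (λ l j → ω l * (w l j * vertex P j i)) ⟩
    Σℚ (λ j → Σℚ (λ l → ω l * (w l j * vertex P j i)))
      ≡⟨ Σ-cong (λ j → trans (Σ-cong (λ l → sym (ℚP.*-assoc (ω l) (w l j) _)))
        (Σ-distribʳ-* (vertex P j i) (λ l → ω l * w l j))) ⟩
    Σℚ (λ j → W j * vertex P j i) ∎
    where open ≡-Reasoning

argmax : ∀ {s} (f : Fin (suc s) → ℚ) → ∃[ k ] (∀ j → f j ≤ f k)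
argmax {zero}  f = zero , λ { zero → ℚP.≤-refl }
argmax {suc s} f with argmax (λ j → f (suc j))
... | k , max with f zero ℚP.≤? f (suc k)
...   | yes f0≤ = suc k , λ { zero → f0≤ ; (suc j) → max j }
...   | no  f0≰ = zero  , λ { zero → ℚP.≤-refl
                          ; (suc j) → ℚP.≤-trans (max j) (ℚP.<⇒≤ (ℚP.≰⇒> f0≰)) }

argmin : ∀ {s} (f : Fin (suc s) → ℚ) → ∃[ k ] (∀ j → f k ≤ f j)
argmin {zero}  f = zero , λ { zero → ℚP.≤-refl }
argmin {suc s} f with argmin (λ j → f (suc j))
... | k , min with f (suc k) ℚP.≤? f zero
...   | yes ≤f0 = suc k , λ { zero → ≤f0 ; (suc j) → min j }
...   | no  ≰f0 = zero  , λ { zero → ℚP.≤-refl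
                          ; (suc j) → ℚP.≤-trans (ℚP.<⇒≤ (ℚP.≰⇒> ≰f0)) (min j) }

module _ {n} (u : Pt n) (P : LatticePolytope n) where

  maxVertex minVertex : Fin (suc (size P))
  maxVertex = proj₁ (argmax (λ j → u · vertex P j))
  minVertex = proj₁ (argmin (λ j → u · vertex P j))

  maxVal minVal : ℚ
  maxVal = u · vertex P maxVertex
  minVal = u · vertex P minVertex

  ·≤maxVal : ∀ {x} → ⟦ P ⟧ x → u · x ≤ maxVal
  ·≤maxVal x∈P@(w , w≥0 , Σw≡1 , _) =
    subst₂ _≤_ (sym (·-on-polytope u P x∈P)) (Σ-convex-const w maxVal Σw≡1)
    (Σ-mono-≤ (λ j → *-monoˡ-≤-0≤ (w≥0 j) (proj₂ (argmax (λ j → u · vertex P j)) j)))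

  minVal≤· : ∀ {x} → ⟦ P ⟧ x → minVal ≤ u · x
  minVal≤· x∈P@(w , w≥0 , Σw≡1 , _) =
    subst₂ _≤_ (Σ-convex-const w minVal Σw≡1) (sym (·-on-polytope u P x∈P))
    (Σ-mono-≤ (λ j → *-monoˡ-≤-0≤ (w≥0 j) (proj₂ (argmin (λ j → u · vertex P j)) j)))

  face⇒·≡maxVal : ∀ {x} → face u ⟦ P ⟧ x → u · x ≡ maxVal
  face⇒·≡maxVal (x∈P , max) = ℚP.≤-antisym (·≤maxVal x∈P) (max _ (vertex∈ P maxVertex))

  ·≡maxVal⇒face : ∀ {x} → ⟦ P ⟧ x → u · x ≡ maxVal → face u ⟦ P ⟧ x
  ·≡maxVal⇒face x∈P ·x≡max = x∈P , λ y y∈P → subst (_ ≤_) (sym ·x≡max) (·≤maxVal y∈P)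

  maxVertex∈face : face u ⟦ P ⟧ (vertex P maxVertex)
  maxVertex∈face = ·≡maxVal⇒face (vertex∈ P maxVertex) refl

  face-supported-on-maximal-vertices : ∀ {x} (x∈P : ⟦ P ⟧ x) → face u ⟦ P ⟧ x →
                                       ∀ j → proj₁ x∈P j ≢ 0ℚ → u · vertex P j ≡ maxVal
  face-supported-on-maximal-vertices {x} x∈P@(w , w≥0 , Σw≡1 , _) x∈face j wj≢0 =
    sym (p-q≡0⇒p≡q (p*q≡0⇒q≡0 wj≢0 (Σ-nonneg≡0⇒≡0 slack≥0 Σslack≡0 j)))
    where
    slack≥0 : ∀ j → 0ℚ ≤ w j * (maxVal - u · vertex P j)
    slack≥0 j = *-nonneg (w≥0 j) (p≤q⇒0≤q-p (·≤maxVal (vertex∈ P j)))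
    Σslack≡0 : Σℚ (λ j → w j * (maxVal - u · vertex P j)) ≡ 0ℚ
    Σslack≡0 = begin
      Σℚ (λ j → w j * (maxVal - u · vertex P j))
        ≡⟨ Σ-cong (λ j → ℚP.*-distribˡ-+ (w j) maxVal (- (u · vertex P j))) ⟩
      Σℚ (λ j → w j * maxVal + w j * - (u · vertex P j))
        ≡⟨ Σ-cong (λ j → cong (w j * maxVal +_) (sym (ℚP.neg-distribʳ-* (w j) (u · vertex P j)))) ⟩
      Σℚ (λ j → w j * maxVal - w j * (u · vertex P j))
        ≡⟨ Σ-distrib-- (λ j → w j * maxVal) (λ j → w j * (u · vertex P j)) ⟩
      Σℚ (λ j → w j * maxVal) - Σℚ (λ j → w j * (u · vertex P j))
        ≡⟨ cong₂ _-_ (Σ-convex-const w maxVal Σw≡1) (sym (·-on-polytope u P x∈P)) ⟩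
      maxVal - u · x
        ≡⟨ p≡q⇒p-q≡0 (sym (face⇒·≡maxVal x∈face)) ⟩
      0ℚ ∎
      where open ≡-Reasoning

data FaceKind {n} (u : Pt n) (P : LatticePolytope n) : Set where
  whole  : (∀ x → ⟦ P ⟧ x → face u ⟦ P ⟧ x) → FaceKind u P
  point  : (p : Pt n) → face u ⟦ P ⟧ ≃ singleton p → FaceKind u P
  proper : IsProperFace (face u ⟦ P ⟧) ⟦ P ⟧ → FaceKind u P

module _ {n} (u : Pt n) (P : LatticePolytope n) where

  IsMaximalVertex : Fin (suc (size P)) → Set
  IsMaximalVertex j = u · vertex P j ≡ maxVal u P

  isMaximalVertex? : ∀ j → Dec (IsMaximalVertex j)
  isMaximalVertex? j = u · vertex P j ℚP.≟ maxVal u P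

  all-maximal⇒face-whole : (∀ j → IsMaximalVertex j) → ∀ x → ⟦ P ⟧ x → face u ⟦ P ⟧ x
  all-maximal⇒face-whole allMax x x∈P@(w , _ , Σw≡1 , _) = ·≡maxVal⇒face u P x∈P (begin
    u · x                             ≡⟨ ·-on-polytope u P x∈P ⟩
    Σℚ (λ j → w j * (u · vertex P j)) ≡⟨ Σ-cong (λ j → cong (w j *_) (allMax j)) ⟩
    Σℚ (λ j → w j * maxVal u P)       ≡⟨ Σ-convex-const w (maxVal u P) Σw≡1 ⟩
    maxVal u P                        ∎)
    where open ≡-Reasoning

  nonmaximal⇒face≄P : ∀ j → ¬ IsMaximalVertex j → ¬ (face u ⟦ P ⟧ ≃ ⟦ P ⟧)
  nonmaximal⇒face≄P j notMax face≃P =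
    notMax (face⇒·≡maxVal u P (proj₂ (face≃P (vertex P j)) (vertex∈ P j)))

  distinct-maximal⇒¬IsVertex : ∀ j j′ → IsMaximalVertex j → IsMaximalVertex j′ →
                               ¬ (vertex P j ≈ₚ vertex P j′) → ¬ IsVertex ⟦ P ⟧ (face u ⟦ P ⟧)
  distinct-maximal⇒¬IsVertex j j′ jMax j′Max j≉j′ (_ , p , face≃p) =
    j≉j′ (≈ₚ-trans (at-p j jMax) (≈ₚ-sym (at-p j′ j′Max)))
    where
    at-p : ∀ k → IsMaximalVertex k → vertex P k ≈ₚ p
    at-p k kMax = proj₁ (face≃p (vertex P k)) (·≡maxVal⇒face u P (vertex∈ P k) kMax)

  maximal-equal⇒face≃point : (∀ j j′ → IsMaximalVertex j → IsMaximalVertex j′ →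
                                          vertex P j ≈ₚ vertex P j′) →
                             face u ⟦ P ⟧ ≃ singleton (vertex P (maxVertex u P))
  maximal-equal⇒face≃point allEqual x = to , from
    where
    top : Pt n
    top = vertex P (maxVertex u P)
    to : face u ⟦ P ⟧ x → x ≈ₚ top
    to x∈face@(x∈P@(w , _ , Σw≡1 , x≈) , _) i = begin
      x i
        ≡⟨ x≈ i ⟩
      Σℚ (λ j → w j * vertex P j i)
        ≡⟨ Σ-cong (λ j → *-congˡ-on-support (w j) (λ wj≢0 → allEqual j (maxVertex u P)
          (face-supported-on-maximal-vertices u P x∈P x∈face j wj≢0) refl i)) ⟩
      Σℚ (λ j → w j * top i)
        ≡⟨ Σ-convex-const w (top i) Σw≡1 ⟩
      top i ∎
      where open ≡-Reasoning
    from : x ≈ₚ top → face u ⟦ P ⟧ x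
    from x≈top = ·≡maxVal⇒face u P (∈-resp-≈ₚ P (vertex∈ P (maxVertex u P)) (≈ₚ-sym x≈top))
                                   (·-congʳ u x≈top)

  faceKind : FaceKind u P
  faceKind with FinP.all? isMaximalVertex?
  ... | yes allMax = whole (all-maximal⇒face-whole allMax)
  ... | no notAllMax with FinP.any? (λ j → FinP.any? (λ j′ →
                            isMaximalVertex? j ×-dec isMaximalVertex? j′ ×-dec ¬? (vertex P j ≈ₚ? vertex P j′)))
  ...   | yes (j , j′ , jMax , j′Max , j≉j′) =
          proper ((u , ≃-refl) , nonmaximal⇒face≄P j₀ j₀-notMax ,
                  distinct-maximal⇒¬IsVertex j j′ jMax j′Max j≉j′)
    where
    j₀ : Fin (suc (size P))
    j₀ = proj₁ (FinP.¬∀⟶∃¬ _ _ isMaximalVertex? notAllMax)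
    j₀-notMax : ¬ IsMaximalVertex j₀
    j₀-notMax = proj₂ (FinP.¬∀⟶∃¬ _ _ isMaximalVertex? notAllMax)
  ...   | no noDistinct = point (vertex P (maxVertex u P)) (maximal-equal⇒face≃point (λ j j′ jMax j′Max →
          decidable-stable (vertex P j ≈ₚ? vertex P j′) (λ j≉j′ → noDistinct (j , j′ , jMax , j′Max , j≉j′))))

isProperFace? : ∀ {n} (u : Pt n) (P : LatticePolytope n) → Dec (IsProperFace (face u ⟦ P ⟧) ⟦ P ⟧)
isProperFace? u P with faceKind u P
... | whole all        = no (λ (_ , face≄P , _) → face≄P (λ x → proj₁ , all x))
... | point p face≃p   = no (λ (_ , _ , not-vertex) → not-vertex ((u , ≃-refl) , (p , face≃p)))
... | proper isProper  = yes isProper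

-- Minkowski sums of families of polytopes

ΣM⇒components : ∀ {n m} (F : Fin m → PSet n) {x} → ΣM F x →
                Σ[ c ∈ (Fin m → Pt n) ] ((∀ s → F s (c s)) × x ≈ₚ Σpt c)
ΣM⇒components {m = zero}  F x≈0 = (λ ()) , (λ ()) , x≈0
ΣM⇒components {m = suc m} F (p , q , Fp , Rq , x≈p+q) with ΣM⇒components (λ j → F (suc j)) Rq
... | c , Fc , q≈Σc = (λ { zero → p ; (suc j) → c j }) , (λ { zero → Fp ; (suc j) → Fc j }) ,
                      λ i → trans (x≈p+q i) (cong (p i +_) (q≈Σc i))

components⇒ΣM : ∀ {n m} (F : Fin m → PSet n) (c : Fin m → Pt n) → (∀ s → F s (c s)) → ΣM F (Σpt c)
components⇒ΣM {m = zero}  F c Fc = λ i → refl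
components⇒ΣM {m = suc m} F c Fc =
  c zero , Σpt (λ j → c (suc j)) , Fc zero ,
  components⇒ΣM (λ j → F (suc j)) (λ j → c (suc j)) (λ j → Fc (suc j)) , λ i → refl

module _ {n m} (u : Pt n) (S : Fam n m) where

  maxVertices minVertices : Fin m → Pt n
  maxVertices s = vertex (S s) (maxVertex u (S s))
  minVertices s = vertex (S s) (minVertex u (S s))

  maxPt minPt : Pt n
  maxPt = Σpt maxVertices
  minPt = Σpt minVertices

  maxPt∈ΣS : ΣS S maxPt
  maxPt∈ΣS = components⇒ΣM (λ s → ⟦ S s ⟧) maxVertices (λ s → vertex∈ (S s) (maxVertex u (S s)))

  minPt∈ΣS : ΣS S minPt
  minPt∈ΣS = components⇒ΣM (λ s → ⟦ S s ⟧) minVertices (λ s → vertex∈ (S s) (minVertex u (S s)))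

  ·-components : ∀ {x} (c : Fin m → Pt n) → x ≈ₚ Σpt c → u · x ≡ Σℚ (λ s → u · c s)
  ·-components c x≈Σc = trans (·-congʳ u x≈Σc) (·-Σpt u c)

  ·≤·maxPt : ∀ {x} → ΣS S x → u · x ≤ u · maxPt
  ·≤·maxPt x∈ΣS with ΣM⇒components (λ s → ⟦ S s ⟧) x∈ΣS
  ... | c , c∈S , x≈Σc = subst₂ _≤_ (sym (·-components c x≈Σc)) (sym (·-Σpt u maxVertices))
                                    (Σ-mono-≤ (λ s → ·≤maxVal u (S s) (c∈S s)))

  ·minPt≤· : ∀ {x} → ΣS S x → u · minPt ≤ u · x
  ·minPt≤· x∈ΣS with ΣM⇒components (λ s → ⟦ S s ⟧) x∈ΣS
  ... | c , c∈S , x≈Σc = subst₂ _≤_ (sym (·-Σpt u minVertices)) (sym (·-components c x≈Σc))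
                                    (Σ-mono-≤ (λ s → minVal≤· u (S s) (c∈S s)))

  face-ΣS⇒face-components : ∀ {x} → face u (ΣS S) x → (c : Fin m → Pt n) → (∀ s → ⟦ S s ⟧ (c s)) →
                            x ≈ₚ Σpt c → ∀ s → face u ⟦ S s ⟧ (c s)
  face-ΣS⇒face-components (_ , max) c c∈S x≈Σc s = ·≡maxVal⇒face u (S s) (c∈S s)
    (Σ-≤-tight (λ s → ·≤maxVal u (S s) (c∈S s))
               (subst₂ _≤_ (·-Σpt u maxVertices) (·-components c x≈Σc) (max maxPt maxPt∈ΣS)) s)

neg-cancel-≤ : ∀ {p q} → - p ≤ - q → q ≤ p
neg-cancel-≤ {p} {q} -p≤-q = subst₂ _≤_ (neg-neg q) (neg-neg p) (ℚP.neg-antimono-≤ -p≤-q)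
  where
  neg-neg : ∀ r → - - r ≡ r
  neg-neg = solve 1 (λ r → :- :- r := r) refl

face-negZ⇒minimizer : ∀ {n} (v : ZPt n) (A : PSet n) {x} → face (ιv (negZ v)) A x →
                      ∀ y → A y → ιv v · x ≤ ιv v · y
face-negZ⇒minimizer v A {x} (_ , max) y Ay = neg-cancel-≤ (subst₂ _≤_ (·-negZ v y) (·-negZ v x) (max y Ay))

minimizer⇒face-negZ : ∀ {n} (v : ZPt n) (A : PSet n) {x} → A x → (∀ y → A y → ιv v · x ≤ ιv v · y) →
                      face (ιv (negZ v)) A x
minimizer⇒face-negZ v A {x} Ax min =
  Ax , λ y Ay → subst₂ _≤_ (sym (·-negZ v y)) (sym (·-negZ v x)) (ℚP.neg-antimono-≤ (min y Ay))

cons : ∀ {n K} → Pt n → (Fin K → Pt n) → Fin (suc K) → Pt n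
cons q p zero    = q
cons q p (suc j) = p j

AffIndep-cons : ∀ {n K} (u : Pt n) μ (p : Fin (suc K) → Pt n) (q : Pt n) →
                (∀ j → u · p j ≡ μ) → u · q ≢ μ → AffIndep p → AffIndep {k = suc K} (cons q p)
AffIndep-cons {K = K} u μ p q p-on q-off p-indep c Σc≡0 Σcp≡0 = c≡0
  where
  t : Fin (suc K) → ℚ
  t j = c (suc j)
  Σt≡-c₀ : Σℚ t ≡ - c zero
  Σt≡-c₀ = begin
    Σℚ t                     ≡⟨ solve 2 (λ a b → b := (a :+ b) :- a) refl (c zero) (Σℚ t) ⟩
    (c zero + Σℚ t) - c zero ≡⟨ cong (_- c zero) Σc≡0 ⟩
    0ℚ - c zero              ≡⟨ ℚP.+-identityˡ (- c zero) ⟩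
    - c zero                 ∎
    where open ≡-Reasoning
  c₀[uq-μ]≡0 : c zero * (u · q - μ) ≡ 0ℚ
  c₀[uq-μ]≡0 = begin
    c zero * (u · q - μ)
      ≡⟨ solve 3 (λ c a m → c :* (a :- m) := c :* a :+ (:- c) :* m) refl (c zero) (u · q) μ ⟩
    c zero * (u · q) + - c zero * μ
      ≡⟨ cong (λ z → c zero * (u · q) + z * μ) (sym Σt≡-c₀) ⟩
    c zero * (u · q) + Σℚ t * μ
      ≡⟨ cong (c zero * (u · q) +_) (sym (Σ-distribʳ-* μ t)) ⟩
    c zero * (u · q) + Σℚ (λ j → t j * μ)
      ≡⟨ cong (c zero * (u · q) +_) (Σ-cong (λ j → cong (t j *_) (sym (p-on j)))) ⟩
    Σℚ (λ j → c j * (u · cons q p j))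
      ≡⟨ sym (·-lincomb u c (cons q p)) ⟩
    u · lincomb c (cons q p)
      ≡⟨ trans (·-congʳ u Σcp≡0) (·-zeroʳ u) ⟩
    0ℚ ∎
    where open ≡-Reasoning
  c₀≡0 : c zero ≡ 0ℚ
  c₀≡0 = p*q≡0⇒q≡0 (λ uq-μ≡0 → q-off (p-q≡0⇒p≡q uq-μ≡0))
                   (trans (ℚP.*-comm (u · q - μ) (c zero)) c₀[uq-μ]≡0)
  Σtp≡0 : lincomb t p ≈ₚ zeroPt
  Σtp≡0 i = trans (sym (ℚP.+-identityˡ _))
                  (trans (cong (_+ lincomb t p i) (sym (trans (cong (_* q i) c₀≡0) (ℚP.*-zeroˡ (q i))))) (Σcp≡0 i))
  c≡0 : ∀ j → c j ≡ 0ℚ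
  c≡0 zero    = c₀≡0
  c≡0 (suc j) = p-indep t (trans Σt≡-c₀ (cong -_ c₀≡0)) Σtp≡0 j

AffIndep-homothety : ∀ {n K} (p q : Fin (suc K) → Pt n) (q₀ : Pt n) κ → κ ≢ 0ℚ →
                     (∀ j i → q j i ≡ q₀ i + κ * p j i) → AffIndep p → AffIndep q
AffIndep-homothety p q q₀ κ κ≢0 q≡ p-indep c Σc≡0 Σcq≡0 = p-indep c Σc≡0 Σcp≡0
  where
  Σcp≡0 : lincomb c p ≈ₚ zeroPt
  Σcp≡0 i = p*q≡0⇒q≡0 κ≢0 (begin
    κ * lincomb c p i
      ≡⟨ sym (ℚP.+-identityˡ _) ⟩
    0ℚ + κ * lincomb c p i
      ≡⟨ cong (_+ κ * lincomb c p i) (sym (trans (cong (_* q₀ i) Σc≡0) (ℚP.*-zeroˡ (q₀ i)))) ⟩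
    Σℚ c * q₀ i + κ * lincomb c p i
      ≡⟨ cong₂ _+_ (sym (Σ-distribʳ-* (q₀ i) c)) (sym (Σ-distribˡ-* κ (λ j → c j * p j i))) ⟩
    Σℚ (λ j → c j * q₀ i) + Σℚ (λ j → κ * (c j * p j i))
      ≡⟨ sym (Σ-distrib-+ (λ j → c j * q₀ i) (λ j → κ * (c j * p j i))) ⟩
    Σℚ (λ j → c j * q₀ i + κ * (c j * p j i))
      ≡⟨ Σ-cong (λ j → trans (factor (c j) (q₀ i) κ (p j i)) (cong (c j *_) (sym (q≡ j i)))) ⟩
    lincomb c q i
      ≡⟨ Σcq≡0 i ⟩
    0ℚ ∎)
    where
    open ≡-Reasoning
    factor : ∀ c a k b → c * a + k * (c * b) ≡ c * (a + k * b)
    factor = solve 4 (λ c a k b → c :* a :+ k :* (c :* b) := c :* (a :+ k :* b)) refl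

-- Faces of a hierarchical family

Flat : ∀ {n} → Pt n → PSet n → Set
Flat u A = ∀ {x y} → A x → A y → u · x ≡ u · y

face-flat : ∀ {n} (u : Pt n) (A : PSet n) → Flat u (face u A)
face-flat u A {x} {y} (Ax , x-max) (Ay , y-max) = ℚP.≤-antisym (y-max x Ax) (x-max y Ay)

Flat-resp-≃ : ∀ {n} {u : Pt n} {A B : PSet n} → A ≃ B → Flat u A → Flat u B
Flat-resp-≃ A≃B flat Bx By = flat (proj₂ (A≃B _) Bx) (proj₂ (A≃B _) By)

combination : ∀ {n m} → Pt n → (Fin m → ℕ) → (Fin m → Pt n) → Pt n
combination β y e = β ⊕ Σpt (λ r → ι (ℤ.+ y r) ⊛ e r)

·-combination : ∀ {n m} (u β : Pt n) (y : Fin m → ℕ) (e : Fin m → Pt n) →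
                u · combination β y e ≡ u · β + Σℚ (λ r → ι (ℤ.+ y r) * (u · e r))
·-combination u β y e = trans (·-distrib-⊕ u β _) (cong (u · β +_)
  (trans (·-Σpt u (λ r → ι (ℤ.+ y r) ⊛ e r)) (Σ-cong (λ r → ·-⊛ u (ι (ℤ.+ y r)) (e r)))))

module _ {n m} (S : Fam n m) where

  DilatedSum : ZPt n → (Fin m → ℕ) → PSet n
  DilatedSum t y = translate t (ΣM (λ r → dil (y r) ⟦ S r ⟧))

  combination∈DilatedSum : ∀ t y (e : Fin m → Pt n) → (∀ r → ⟦ S r ⟧ (e r)) →
                           DilatedSum t y (combination (ιv t) y e)
  combination∈DilatedSum t y e e∈S =
    _ , components⇒ΣM (λ r → dil (y r) ⟦ S r ⟧) (λ r → ι (ℤ.+ y r) ⊛ e r) (λ r → e r , e∈S r , λ i → refl) ,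
    λ i → refl

  DilatedSum⇒combination : ∀ t y {x} → DilatedSum t y x →
                           Σ[ e ∈ (Fin m → Pt n) ] ((∀ r → ⟦ S r ⟧ (e r)) × x ≈ₚ combination (ιv t) y e)
  DilatedSum⇒combination t y (q , q∈ΣM , x≈t+q) with ΣM⇒components (λ r → dil (y r) ⟦ S r ⟧) q∈ΣM
  ... | d , d∈dil , q≈Σd = (λ r → proj₁ (d∈dil r)) , (λ r → proj₁ (proj₂ (d∈dil r))) ,
        λ i → trans (x≈t+q i) (cong (ιv t i +_) (trans (q≈Σd i) (Σ-cong (λ r → proj₂ (proj₂ (d∈dil r)) i))))

  base : Fin m → Pt n
  base r = vertex (S r) zero

  base-with : Fin m → Pt n → Fin m → Pt n
  base-with r x = updateAt base r (λ _ → x)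

  base-with∈S : ∀ r {x} → ⟦ S r ⟧ x → ∀ r′ → ⟦ S r′ ⟧ (base-with r x r′)
  base-with∈S r x∈S r′ with r′ FinP.≟ r
  ... | yes refl = subst ⟦ S r ⟧ (sym (updateAt-updates r base)) x∈S
  ... | no r′≢r  = subst ⟦ S r′ ⟧ (sym (updateAt-minimal r′ r base r′≢r)) (vertex∈ (S r′) zero)

  -- Moving the r-th summand point through S_r changes u · (t + Σ y_r e_r) by y_r times as much.
  Flat-dilated-summand : ∀ {u : Pt n} t y → Flat u (DilatedSum t y) → ∀ r → y r ≢ 0 → Flat u ⟦ S r ⟧
  Flat-dilated-summand {u} t y flat r yr≢0 {x} {x′} x∈S x′∈S =
    p-q≡0⇒p≡q (p*q≡0⇒q≡0 (ι-nonzero yr≢0) yr[ux-ux′]≡0)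
    where
    F : Pt n → Fin m → ℚ
    F z r′ = ι (ℤ.+ y r′) * (u · base-with r z r′)
    F-at-r : ∀ z → F z r ≡ ι (ℤ.+ y r) * (u · z)
    F-at-r z = cong (λ w → ι (ℤ.+ y r) * (u · w)) (updateAt-updates r base)
    F-off-r : ∀ r′ → r′ ≢ r → F x r′ ≡ F x′ r′
    F-off-r r′ r′≢r = cong (λ w → ι (ℤ.+ y r′) * (u · w))
                           (trans (updateAt-minimal r′ r base r′≢r) (sym (updateAt-minimal r′ r base r′≢r)))
    moved : Pt n → Pt n
    moved z = combination (ιv t) y (base-with r z)
    yr[ux-ux′]≡0 : ι (ℤ.+ y r) * (u · x - u · x′) ≡ 0ℚ
    yr[ux-ux′]≡0 = begin
      ι (ℤ.+ y r) * (u · x - u · x′)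
        ≡⟨ solve 3 (λ a b c → a :* (b :- c) := a :* b :- a :* c) refl (ι (ℤ.+ y r)) (u · x) (u · x′) ⟩
      ι (ℤ.+ y r) * (u · x) - ι (ℤ.+ y r) * (u · x′)
        ≡⟨ sym (cong₂ _-_ (F-at-r x) (F-at-r x′)) ⟩
      F x r - F x′ r
        ≡⟨ sym (Σ-differ-at r (F x) (F x′) F-off-r) ⟩
      Σℚ (F x) - Σℚ (F x′)
        ≡⟨ solve 3 (λ a b c → b :- c := (a :+ b) :- (a :+ c)) refl (u · ιv t) (Σℚ (F x)) (Σℚ (F x′)) ⟩
      (u · ιv t + Σℚ (F x)) - (u · ιv t + Σℚ (F x′))
        ≡⟨ sym (cong₂ _-_ (·-combination u (ιv t) y (base-with r x)) (·-combination u (ιv t) y (base-with r x′))) ⟩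
      u · moved x - u · moved x′
        ≡⟨ p≡q⇒p-q≡0 (flat (combination∈DilatedSum t y _ (base-with∈S r x∈S))
          (combination∈DilatedSum t y _ (base-with∈S r x′∈S))) ⟩
      0ℚ ∎
      where open ≡-Reasoning

record FaceSplitting {n m} (u : Pt n) (S : Fam n m) (F : PSet n) : Set where
  field
    offset : Pt n
    mult   : Fin m → ℕ
    flat   : ∀ r → mult r ≢ 0 → Flat u ⟦ S r ⟧
    split  : ∀ {x} → F x →
             Σ[ e ∈ (Fin m → Pt n) ] ((∀ r → ⟦ S r ⟧ (e r)) × x ≈ₚ combination offset mult e)

indicator : ∀ {m} → Fin m → Fin m → ℕ
indicator s r = if does (s FinP.≟ r) then 1 else 0

-- A whole face is 1·S s, a vertex a translate of the empty sum, and a proper face lies in ℕ𝒮.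
faceSplitting : ∀ {n m} (S : Fam n m) → Hierarchical S → ∀ u s → FaceSplitting u S (face u ⟦ S s ⟧)
faceSplitting {m = m} S hier u s with faceKind u (S s)
... | whole all = record
  { offset = zeroPt
  ; mult   = indicator s
  ; flat   = flat
  ; split  = λ {x} x∈face → base-with S s x , base-with∈S S s (proj₁ x∈face) , as-combination x
  }
  where
  flat : ∀ r → indicator s r ≢ 0 → Flat u ⟦ S r ⟧
  flat r ind≢0 with s FinP.≟ r
  ... | yes refl = λ x∈S y∈S → face-flat u ⟦ S s ⟧ (all _ x∈S) (all _ y∈S)
  ... | no  _    = ⊥-elim (ind≢0 refl)
  as-combination : ∀ x → x ≈ₚ combination zeroPt (indicator s) (base-with S s x)
  as-combination x i = sym (trans (ℚP.+-identityˡ _) (trans (Σ-cong term) (Σ-δ s (λ _ → x i))))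
    where
    term : ∀ r → ι (ℤ.+ indicator s r) * base-with S s x r i ≡ δ s r * x i
    term r with s FinP.≟ r
    ... | yes refl = cong (λ w → 1ℚ * w i) (updateAt-updates s (base S))
    ... | no  _    = trans (ℚP.*-zeroˡ (base-with S s x r i)) (sym (ℚP.*-zeroˡ (x i)))
... | point p face≃p = record
  { offset = p
  ; mult   = λ _ → 0
  ; flat   = λ r 0≢0 → ⊥-elim (0≢0 refl)
  ; split  = λ {x} x∈face → base S , (λ r → vertex∈ (S r) zero) , as-combination x∈face
  }
  where
  as-combination : ∀ {x} → face u ⟦ S s ⟧ x → x ≈ₚ combination p (λ _ → 0) (base S)
  as-combination {x} x∈face i = trans (proj₁ (face≃p x) x∈face i) (sym (trans
    (cong (p i +_) (trans (Σ-cong (λ r → ℚP.*-zeroˡ (base S r i))) (Σ-zero m))) (ℚP.+-identityʳ (p i))))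
... | proper isProper with hier s u isProper
...   | _ , _ , y , t , face≃sum = record
  { offset = ιv t
  ; mult   = y
  ; flat   = Flat-dilated-summand S {u} t y (Flat-resp-≃ {u = u} face≃sum (face-flat u ⟦ S s ⟧))
  ; split  = λ {x} x∈face → DilatedSum⇒combination S t y (proj₁ (face≃sum x) x∈face)
  }

-- The face opposite to a facet of ΣS

module OppositeFace {n m} (S : Fam n m) (u : Pt n) (splitting : ∀ s → FaceSplitting u S (face u ⟦ S s ⟧)) where
  open FaceSplitting

  Y : Fin m → Fin m → ℚ
  Y s r = ι (ℤ.+ mult (splitting s) r)

  Y-nonneg : ∀ s r → 0ℚ ≤ Y s r
  Y-nonneg s r = ι-nonneg (mult (splitting s) r)

  W : Fin m → ℚ
  W r = Σℚ (λ s → Y s r)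

  N : ℚ
  N = 1ℚ + Σℚ (λ s → Σℚ (Y s))

  0<N : 0ℚ < N
  0<N = ℚP.+-mono-<-≤ (ℚP.positive⁻¹ 1ℚ) (Σ-nonneg (λ s → Σ-nonneg (Y-nonneg s)))

  instance
    N-nonZero : ℚ.NonZero N
    N-nonZero = ℚ.>-nonZero 0<N

  κ : ℚ
  κ = ℚ.1/ N

  0<κ : 0ℚ < κ
  0<κ = ℚP.positive⁻¹ κ {{ℚP.1/pos⇒pos N {{ℚ.positive 0<N}}}}

  κ≢0 : κ ≢ 0ℚ
  κ≢0 κ≡0 = ℚP.<-irrefl (sym κ≡0) 0<κ

  κW≤1 : ∀ r → κ * W r ≤ 1ℚ
  κW≤1 r = subst (κ * W r ≤_) (ℚP.*-inverseˡ N) (*-monoˡ-≤-0≤ (ℚP.<⇒≤ 0<κ) W≤N)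
    where
    T : ℚ
    T = Σℚ (λ s → Σℚ (Y s))
    W≤N : W r ≤ N
    W≤N = ℚP.≤-trans (Σ-mono-≤ (λ s → term≤Σ (Y-nonneg s) r))
                     (subst (_≤ N) (ℚP.+-identityˡ T) (ℚP.+-monoˡ-≤ T (ℚP.nonNegative⁻¹ 1ℚ)))

  weights : Fin m → Fin (suc m) → ℚ
  weights r zero    = 1ℚ - κ * W r
  weights r (suc s) = κ * Y s r

  weights-nonneg : ∀ r l → 0ℚ ≤ weights r l
  weights-nonneg r zero    = p≤q⇒0≤q-p (κW≤1 r)
  weights-nonneg r (suc s) = *-nonneg (ℚP.<⇒≤ 0<κ) (Y-nonneg s r)

  Σweights≡1 : ∀ r → Σℚ (weights r) ≡ 1ℚ
  Σweights≡1 r = trans (cong (1ℚ - κ * W r +_) (Σ-distribˡ-* κ (λ s → Y s r)))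
                       (solve 2 (λ k w → con 1ℚ :- k :* w :+ k :* w := con 1ℚ) refl κ (W r))

  q₀ : Pt n
  q₀ i = Σℚ (λ r → weights r zero * minVertices u S r i) - κ * Σℚ (λ s → offset (splitting s) i)

  module _ {p} (p∈face : face u (ΣS S) p) where

    c : Fin m → Pt n
    c = proj₁ (ΣM⇒components (λ s → ⟦ S s ⟧) (proj₁ p∈face))

    p≈Σc : p ≈ₚ Σpt c
    p≈Σc = proj₂ (proj₂ (ΣM⇒components (λ s → ⟦ S s ⟧) (proj₁ p∈face)))

    c∈face : ∀ s → face u ⟦ S s ⟧ (c s)
    c∈face = face-ΣS⇒face-components u S p∈face c
               (proj₁ (proj₂ (ΣM⇒components (λ s → ⟦ S s ⟧) (proj₁ p∈face)))) p≈Σc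

    e : Fin m → Fin m → Pt n
    e s = proj₁ (split (splitting s) (c∈face s))

    e∈S : ∀ s r → ⟦ S r ⟧ (e s r)
    e∈S s = proj₁ (proj₂ (split (splitting s) (c∈face s)))

    c≈ : ∀ s → c s ≈ₚ combination (offset (splitting s)) (mult (splitting s)) (e s)
    c≈ s = proj₂ (proj₂ (split (splitting s) (c∈face s)))

    points : Fin m → Fin (suc m) → Pt n
    points r zero    = minVertices u S r
    points r (suc s) = e s r

    points∈S : ∀ r l → ⟦ S r ⟧ (points r l)
    points∈S r zero    = vertex∈ (S r) (minVertex u (S r))
    points∈S r (suc s) = e∈S s r

    points-minimal : ∀ r l → weights r l ≢ 0ℚ → u · points r l ≡ minVal u (S r)
    points-minimal r zero    _    = refl
    points-minimal r (suc s) w≢0 = flat (splitting s) r mult≢0 (e∈S s r) (points∈S r zero)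
      where
      mult≢0 : mult (splitting s) r ≢ 0
      mult≢0 mult≡0 = w≢0 (trans (cong (λ k → κ * ι (ℤ.+ k)) mult≡0) (ℚP.*-zeroʳ κ))

    part : Fin m → Pt n
    part r = lincomb (weights r) (points r)

    part∈S : ∀ r → ⟦ S r ⟧ (part r)
    part∈S r = convex-combination∈ (S r) (weights r) (points r) (weights-nonneg r) (Σweights≡1 r) (points∈S r)

    ·part : ∀ r → u · part r ≡ minVal u (S r)
    ·part r = begin
      u · part r
        ≡⟨ ·-lincomb u (weights r) (points r) ⟩
      Σℚ (λ l → weights r l * (u · points r l))
        ≡⟨ Σ-cong (λ l → *-congˡ-on-support (weights r l) (points-minimal r l)) ⟩
      Σℚ (λ l → weights r l * minVal u (S r))
        ≡⟨ Σ-convex-const (weights r) (minVal u (S r)) (Σweights≡1 r) ⟩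
      minVal u (S r) ∎
      where open ≡-Reasoning

    image : Pt n
    image = Σpt part

    image∈ΣS : ΣS S image
    image∈ΣS = components⇒ΣM (λ s → ⟦ S s ⟧) part part∈S

    ·image : u · image ≡ u · minPt u S
    ·image = trans (·-Σpt u part) (trans (Σ-cong ·part) (sym (·-Σpt u (minVertices u S))))

    image≈ : ∀ i → image i ≡ q₀ i + κ * p i
    image≈ i = begin
      image i
        ≡⟨ Σ-distrib-+ (λ r → weights r zero * minVertices u S r i) (λ r → Σℚ (λ s → κ * Y s r * e s r i)) ⟩
      G + B
        ≡⟨ solve 3 (λ G B K → G :+ B := (G :- K) :+ (K :+ B)) refl G B (κ * O) ⟩
      (G - κ * O) + (κ * O + B)
        ≡⟨ cong (G - κ * O +_) (sym κp≡κO+B) ⟩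
      q₀ i + κ * p i ∎
      where
      open ≡-Reasoning
      G B O D : ℚ
      G = Σℚ (λ r → weights r zero * minVertices u S r i)
      B = Σℚ (λ r → Σℚ (λ s → κ * Y s r * e s r i))
      O = Σℚ (λ s → offset (splitting s) i)
      D = Σℚ (λ s → Σℚ (λ r → Y s r * e s r i))
      κD≡B : κ * D ≡ B
      κD≡B = begin
        κ * D
          ≡⟨ sym (Σ-distribˡ-* κ (λ s → Σℚ (λ r → Y s r * e s r i))) ⟩
        Σℚ (λ s → κ * Σℚ (λ r → Y s r * e s r i))
          ≡⟨ Σ-cong (λ s → sym (Σ-distribˡ-* κ (λ r → Y s r * e s r i))) ⟩
        Σℚ (λ s → Σℚ (λ r → κ * (Y s r * e s r i)))
          ≡⟨ Σ-cong (λ s → Σ-cong (λ r → sym (ℚP.*-assoc κ (Y s r) (e s r i)))) ⟩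
        Σℚ (λ s → Σℚ (λ r → κ * Y s r * e s r i))
          ≡⟨ Σ-comm (λ s r → κ * Y s r * e s r i) ⟩
        B ∎
      κp≡κO+B : κ * p i ≡ κ * O + B
      κp≡κO+B = begin
        κ * p i
          ≡⟨ cong (κ *_) (trans (p≈Σc i) (Σ-cong (λ s → c≈ s i))) ⟩
        κ * Σℚ (λ s → offset (splitting s) i + Σℚ (λ r → Y s r * e s r i))
          ≡⟨ cong (κ *_) (Σ-distrib-+ (λ s → offset (splitting s) i) (λ s → Σℚ (λ r → Y s r * e s r i))) ⟩
        κ * (O + D)
          ≡⟨ ℚP.*-distribˡ-+ κ O D ⟩
        κ * O + κ * D
          ≡⟨ cong (κ * O +_) κD≡B ⟩
        κ * O + B ∎

module _ {n m} (S : Fam n m) (hier : Hierarchical S) (v : ZPt n) where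
  private
    u : Pt n
    u = ιv v
    open OppositeFace S u (faceSplitting S hier u)

  opposite-face⇒·≡min : ∀ {x} → face (ιv (negZ v)) (ΣS S) x → u · x ≡ u · minPt u S
  opposite-face⇒·≡min x∈face = ℚP.≤-antisym (face-negZ⇒minimizer v (ΣS S) x∈face _ (minPt∈ΣS u S))
                                            (·minPt≤· u S (proj₁ x∈face))

  ·≡min⇒opposite-face : ∀ {x} → ΣS S x → u · x ≡ u · minPt u S → face (ιv (negZ v)) (ΣS S) x
  ·≡min⇒opposite-face x∈ΣS ·x≡min =
    minimizer⇒face-negZ v (ΣS S) x∈ΣS (λ y y∈ΣS → subst (_≤ u · y) (sym ·x≡min) (·minPt≤· u S y∈ΣS))

  ·≡max⇒face : ∀ {x} → ΣS S x → u · x ≡ u · maxPt u S → face u (ΣS S) x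
  ·≡max⇒face x∈ΣS ·x≡max = x∈ΣS , λ y y∈ΣS → subst (u · y ≤_) (sym ·x≡max) (·≤·maxPt u S y∈ΣS)

  -- The homothety gives the lower bound. A (k′+2)-simplex in the opposite face lies in face_u(ΣS)
  -- if u is constant on ΣS, and otherwise extends by the maximum point to a simplex too big for ΣS.
  opposite-face-dim : ∀ {k′} → HasDim (ΣS S) (suc k′) → HasDim (face u (ΣS S)) k′ →
                      HasDim (face (ιv (negZ v)) (ΣS S)) k′
  opposite-face-dim {k′} (_ , ΣS-bound) ((p , p∈face , p-indep) , face-bound) = simplex , bound
    where
    simplex : ∃[ q ] ((∀ j → face (ιv (negZ v)) (ΣS S) (q j)) × AffIndep {k = k′} q)
    simplex = (λ j → image (p∈face j)) ,
      (λ j → ·≡min⇒opposite-face (image∈ΣS (p∈face j)) (·image (p∈face j))) ,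
      AffIndep-homothety p (λ j → image (p∈face j)) q₀ κ κ≢0 (λ j → image≈ (p∈face j)) p-indep
    bound : ∀ (q : Fin (suc (suc k′)) → Pt n) → (∀ j → face (ιv (negZ v)) (ΣS S) (q j)) → ¬ AffIndep q
    bound q q∈face q-indep with u · maxPt u S ℚP.≟ u · minPt u S
    ... | yes max≡min = face-bound q (λ j → ·≡max⇒face (proj₁ (q∈face j))
                                              (trans (opposite-face⇒·≡min (q∈face j)) (sym max≡min))) q-indep
    ... | no  max≢min = ΣS-bound (cons (maxPt u S) q) cons∈ΣS
          (AffIndep-cons u (u · minPt u S) q (maxPt u S) (λ j → opposite-face⇒·≡min (q∈face j)) max≢min q-indep)
      where
      cons∈ΣS : ∀ j → ΣS S (cons (maxPt u S) q j)
      cons∈ΣS zero    = maxPt∈ΣS u S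
      cons∈ΣS (suc j) = proj₁ (q∈face j)

Primitive-negZ : ∀ {n} (v : ZPt n) → Primitive v → Primitive (negZ v)
Primitive-negZ v prim d d∣-v = prim d (λ k → subst (d ∣_) (ℤP.∣-i∣≡∣i∣ (v k)) (d∣-v k))

InDirSpace-negZ : ∀ {n} (P : PSet n) (v : ZPt n) → InDirSpace P (ιv v) → InDirSpace P (ιv (negZ v))
InDirSpace-negZ P v (M , p , q , c , p∈P , q∈P , v≈) = M , q , p , c , q∈P , p∈P , λ k → begin
  ιv (negZ v) k                        ≡⟨ ι-neg (v k) ⟩
  - ιv v k                             ≡⟨ cong -_ (v≈ k) ⟩
  - Σℚ (λ j → c j * (p j k - q j k))   ≡⟨ sym (Σ-neg (λ j → c j * (p j k - q j k))) ⟩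
  Σℚ (λ j → - (c j * (p j k - q j k))) ≡⟨ Σ-cong (λ j → flip (c j) (p j k) (q j k)) ⟩
  Σℚ (λ j → c j * (q j k - p j k))     ∎
  where
  open ≡-Reasoning
  flip : ∀ c a b → - (c * (a - b)) ≡ c * (b - a)
  flip = solve 3 (λ c a b → :- (c :* (a :- b)) := c :* (b :- a)) refl

rows-closed-under-negZ : ∀ {n m r} (S : Fam n m) (H : Fin r → ZPt n) → Hierarchical S →
                         IsHMatrix (ΣS S) H → ∀ i → ∃[ j ] H j ≡ negZ (H i)
rows-closed-under-negZ S H hier (k′ , dim , _ , normal , complete) i with normal i
... | prim , dir , face-dim = complete (negZ (H i))
  (Primitive-negZ (H i) prim , InDirSpace-negZ (ΣS S) (H i) dir , opposite-face-dim S hier (H i) dim face-dim)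

-- The orientation

lexSign : ∀ {n} → ZPt n → Bool
lexSign {zero}  v = false
lexSign {suc n} v with v zero
... | ℤ.+ zero  = lexSign (λ k → v (suc k))
... | ℤ.+ suc _ = true
... | -[1+ _ ]  = false

lexSign-cong : ∀ {n} {v w : ZPt n} → (∀ k → w k ≡ v k) → lexSign w ≡ lexSign v
lexSign-cong {zero}          w≗v = refl
lexSign-cong {suc n} {v} {w} w≗v with w zero | v zero | w≗v zero
... | ℤ.+ zero  | _ | refl = lexSign-cong (λ k → w≗v (suc k))
... | ℤ.+ suc _ | _ | refl = refl
... | -[1+ _ ]  | _ | refl = refl

lexSign-negZ : ∀ {n} (v : ZPt n) → ∃[ k ] v k ≢ ℤ.+ 0 → lexSign (negZ v) ≢ lexSign v
lexSign-negZ {suc n} v (k , vk≢0) with v zero in v₀≡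
... | ℤ.+ suc _ = λ ()
... | -[1+ _ ]  = λ ()
... | ℤ.+ zero with k
...   | zero  = ⊥-elim (vk≢0 v₀≡)
...   | suc k′ = lexSign-negZ (λ k → v (suc k)) (k′ , vk≢0)

Primitive⇒nonzero : ∀ {n} (v : ZPt n) → Primitive v → ∃[ k ] v k ≢ ℤ.+ 0
Primitive⇒nonzero v prim with FinP.all? (λ k → v k ℤ.≟ ℤ.+ 0)
... | yes v≡0 = ⊥-elim (2≢1 (prim 2 (λ k → subst (λ z → 2 ∣ ℤ.∣ z ∣) (sym (v≡0 k)) (2 ∣0))))
  where
  2≢1 : 2 ≢ 1
  2≢1 ()
... | no v≢0 = FinP.¬∀⟶∃¬ _ _ (λ k → v k ℤ.≟ ℤ.+ 0) v≢0

decideSign : Bool → Bool → Bool → Bool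
decideSign a b l = if a then true else if b then false else l

decideSign-swap : ∀ a b {l l′} → a ∧ b ≡ false → l′ ≢ l → decideSign b a l′ ≢ decideSign a b l
decideSign-swap true  true  ()
decideSign-swap true  false _ _     = λ ()
decideSign-swap false true  _ _     = λ ()
decideSign-swap false false _ l′≢l = l′≢l

decideSign-true : ∀ a b {l} → a ∧ b ≡ false → decideSign a b l ≡ true → b ≡ false
decideSign-true true  true  ()
decideSign-true true  false _ _  = refl
decideSign-true false true  _ ()
decideSign-true false false _ _  = refl

module _ {n m} (S : Fam n m) where

  HasProperFace : Pt n → Set
  HasProperFace u = ∃[ s ] IsProperFace (face u ⟦ S s ⟧) ⟦ S s ⟧

  hasProperFace? : ∀ u → Dec (HasProperFace u)
  hasProperFace? u = FinP.any? (λ s → isProperFace? u (S s))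

  HasProperFace-resp : ∀ {u u′} → u ≈ₚ u′ → HasProperFace u → HasProperFace u′
  HasProperFace-resp u≈u′ (s , isProper) = s , IsProperFace-resp (face-cong ⟦ S s ⟧ u≈u′) isProper

  does-hasProperFace?-cong : ∀ {u u′} → u ≈ₚ u′ → does (hasProperFace? u) ≡ does (hasProperFace? u′)
  does-hasProperFace?-cong {u} {u′} u≈u′ =
    does-⇔ (mk⇔ (HasProperFace-resp u≈u′) (HasProperFace-resp (≈ₚ-sym u≈u′)))
           (hasProperFace? u) (hasProperFace? u′)

  Exclusive : ZPt n → Set
  Exclusive v = ¬ (HasProperFace (ιv v) × HasProperFace (ιv (negZ v)))

  orientation : ZPt n → Bool
  orientation v = decideSign (does (hasProperFace? (ιv v))) (does (hasProperFace? (ιv (negZ v)))) (lexSign v)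

  orientation-cong : ∀ {v w : ZPt n} → (∀ k → w k ≡ v k) → orientation w ≡ orientation v
  orientation-cong {v} {w} w≗v
    rewrite does-hasProperFace?-cong {ιv w} {ιv v} (λ k → cong ι (w≗v k))
          | does-hasProperFace?-cong {ιv (negZ w)} {ιv (negZ v)} (λ k → cong (λ z → ι (ℤ.- z)) (w≗v k))
          | lexSign-cong w≗v = refl

  orientation-negZ : ∀ v → ∃[ k ] v k ≢ ℤ.+ 0 → Exclusive v → orientation (negZ v) ≢ orientation v
  orientation-negZ v nonzero exclusive
    rewrite does-hasProperFace?-cong {ιv (negZ (negZ v))} {ιv v} (λ k → cong ι (ℤP.neg-involutive (v k))) =
    decideSign-swap (does (hasProperFace? (ιv v))) (does (hasProperFace? (ιv (negZ v))))
                    (dec-false (hasProperFace? (ιv v) ×-dec hasProperFace? (ιv (negZ v))) exclusive)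
                    (lexSign-negZ v nonzero)

  orientation-positive : ∀ v → Exclusive v → orientation v ≡ true → ¬ HasProperFace (ιv (negZ v))
  orientation-positive v exclusive positive hasProper =
    true≢false (trans (sym (dec-true (hasProperFace? (ιv (negZ v))) hasProper))
      (decideSign-true (does (hasProperFace? (ιv v))) (does (hasProperFace? (ιv (negZ v))))
                       (dec-false (hasProperFace? (ιv v) ×-dec hasProperFace? (ιv (negZ v))) exclusive) positive))
    where
    true≢false : true ≢ false
    true≢false ()

OppositeProperFaces : ∀ {n m} → Fam n m → ZPt n → Set
OppositeProperFaces S v = ∃[ s ] ∃[ s′ ] (IsProperFace (face (ιv v) ⟦ S s ⟧) ⟦ S s ⟧
                                          × IsProperFace (face (ιv (negZ v)) ⟦ S s′ ⟧) ⟦ S s′ ⟧)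

positive⇒¬OppositeProperFaces : ∀ {n m r} (S : Fam n m) (H : Fin r → ZPt n) → Hierarchical S →
                                IsHMatrix (ΣS S) H → ∀ {τ} → IsPositive S H τ →
                                ∀ i → ¬ OppositeProperFaces S (H i)
positive⇒¬OppositeProperFaces S H hier isHMatrix {τ} (orient , positive) i (s , s′ , proper-v , proper-−v)
  with τ i in τi≡
... | true  = positive i τi≡ s′ proper-−v
... | false = opposite-row-positive (rows-closed-under-negZ S H hier isHMatrix i)
  where
  opposite-row-positive : ∃[ j ] H j ≡ negZ (H i) → ⊥
  opposite-row-positive (j , Hj≡−Hi) with τ j in τj≡
  ... | true  = positive j τj≡ s (IsProperFace-resp (face-cong ⟦ S s ⟧ Hi≈−Hj) proper-v)
    where
    Hi≈−Hj : ιv (H i) ≈ₚ ιv (negZ (H j))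
    Hi≈−Hj k = cong ι (sym (trans (cong (λ w → ℤ.- w k) Hj≡−Hi) (ℤP.neg-involutive (H i k))))
  ... | false = orient i j (λ k → cong (λ w → w k) Hj≡−Hi) (trans τj≡ (sym τi≡))

¬OppositeProperFaces⇒positive : ∀ {n m r} (S : Fam n m) (H : Fin r → ZPt n) → IsHMatrix (ΣS S) H →
                                (∀ i → ¬ OppositeProperFaces S (H i)) → ∃[ τ ] IsPositive S H τ
¬OppositeProperFaces⇒positive {r = r} S H (_ , _ , _ , normal , _) none =
  τ , (λ i j Hj≗−Hi τj≡τi → orientation-negZ S (H i) (nonzero i) (exclusive i)
                              (trans (sym (orientation-cong S Hj≗−Hi)) τj≡τi)) ,
      (λ i τi≡true s proper → orientation-positive S (H i) (exclusive i) τi≡true (s , proper))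
  where
  τ : Fin r → Bool
  τ i = orientation S (H i)
  exclusive : ∀ i → Exclusive S (H i)
  exclusive i ((s , proper-v) , (s′ , proper-−v)) = none i (s , s′ , proper-v , proper-−v)
  nonzero : ∀ i → ∃[ k ] H i k ≢ ℤ.+ 0
  nonzero i = Primitive⇒nonzero (H i) (proj₁ (normal i))

proposition31 : ∀ {n m r} (S : Fam n m) (H : Fin r → ZPt n)
    → Distinct S
    → Hierarchical S
    → IsBasis S H
    → IsHMatrix (ΣS S) H
    → (IsPositiveBasis S H
         → ∀ i → ¬ (∃[ s ] ∃[ s′ ]
              (IsProperFace (face (ιv (H i)) ⟦ S s ⟧) ⟦ S s ⟧
               × IsProperFace (face (ιv (negZ (H i))) ⟦ S s′ ⟧) ⟦ S s′ ⟧)))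
       × ((∀ i → ¬ (∃[ s ] ∃[ s′ ]
              (IsProperFace (face (ιv (H i)) ⟦ S s ⟧) ⟦ S s ⟧
               × IsProperFace (face (ιv (negZ (H i))) ⟦ S s′ ⟧) ⟦ S s′ ⟧)))
         → IsPositiveBasis S H)
proposition31 S H _ hier basis isHMatrix =
  (λ (_ , _ , _ , positive) → positive⇒¬OppositeProperFaces S H hier isHMatrix positive) ,
  (λ none → hier , basis , ¬OppositeProperFaces⇒positive S H isHMatrix none)
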